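{- Let $p=7$. For integers $i,j\ge 1$ put $n=7i-j$ and define $$g_{ij}=\begin{cases}+\infty & \text{if } n<0,\\ \frac{n}{12}-\frac{\lfloor n/5\rfloor-1}{4} & \text{if } n\ge 0 \text{ and } n\equiv 1,3 \pmod 5,\\ \frac{n}{12}-\frac{\lfloor n/5\rfloor}{4} & \text{if } n\ge 0 \text{ and } n\equiv 0,2,4 \pmod 5.\end{cases}$$ Let $a$ be any positive integer divisible by $4$, and let $M_1,\ldots,M_a$ be infinite matrices $(M_\ell)_{i,j\ge 1}$ with entries in a $7$-adic ring (e.g. the ring of integers of a finite extension of $\mathbb Q_7$) such that for every $\ell=1,\ldots,a$ and all $i,j\ge1$ we have $\mathrm{ord}_7 (M_\ell)_{ij}\ge g_{ij}$ (so $(M_\ell)_{ij}=0$ whenever $j>7i$). Then for all $i,j\ge 1$, $$\mathrm{ord}_7 (M_1\cdots M_a)_{ij}> \frac{5a}{12}+\frac{i-j}{12}.$$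
   Context: $\mathrm{ord}_7$ denotes the $7$-adic valuation normalized by $\mathrm{ord}_7(7)=1$, with $\mathrm{ord}_7(0)=+\infty$. $\lfloor r\rfloor$ is the greatest integer $\le r$. Products of the infinite matrices are the usual matrix products $(AB)_{ij}=\sum_{k\ge1}A_{ik}B_{kj}$ (finite sums here, since the $i$-th row of each $M_\ell$ vanishes beyond column $7i$). -}

module Defs where

open import Level using (Level; _⊔_) renaming (suc to lsuc)
open import Data.Nat as ℕ using (ℕ; zero; suc; _∸_; _≡ᵇ_)
open import Data.Nat.DivMod using (_/_; _%_)
open import Data.Integer as ℤ using (ℤ; +_)
open import Data.Rational as ℚ using (ℚ)
open import Data.Bool using (if_then_else_)
open import Data.Product using (_×_)
open import Function.Bundles using (_⇔_)
open import Relation.Binary.PropositionalEquality using (_≡_)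
open import Algebra.Bundles using (CommutativeRing)

-- ℚ extended by +∞ (value group of ord_7 together with ord_7(0)=+∞)
data ℚ∞ : Set where
  fin : ℚ → ℚ∞
  ∞   : ℚ∞

infix 4 _≤∞_ _<∞_
data _≤∞_ : ℚ∞ → ℚ∞ → Set where
  fin≤fin : ∀ {p q} → p ℚ.≤ q → fin p ≤∞ fin q
  _≤∞∞    : ∀ x → x ≤∞ ∞

data _<∞_ : ℚ∞ → ℚ∞ → Set where
  fin<fin : ∀ {p q} → p ℚ.< q → fin p <∞ fin q
  fin<∞   : ∀ p → fin p <∞ ∞

infixl 6 _+∞_
_+∞_ : ℚ∞ → ℚ∞ → ℚ∞
fin p +∞ fin q = fin (p ℚ.+ q)
fin _ +∞ ∞     = ∞
∞     +∞ _     = ∞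

min∞ : ℚ∞ → ℚ∞ → ℚ∞
min∞ (fin p) (fin q) = fin (p ℚ.⊓ q)
min∞ (fin p) ∞       = fin p
min∞ ∞       y       = y

-- A "7-adic ring": a commutative ring R with a (rank-one, ℚ-valued)
-- non-archimedean valuation ord_7 : R → ℚ ∪ {+∞}, nonnegative on R
-- (R is a ring of integers), ord_7(x) = ∞ iff x = 0, and ord_7(7) = 1.
-- E.g. the ring of integers of a finite extension of ℚ_7.
record SevenAdicRing (c ℓ : Level) : Set (lsuc (c ⊔ ℓ)) where
  field
    commRing : CommutativeRing c ℓ
  open CommutativeRing commRing public
  field
    ord      : Carrier → ℚ∞
    ord-cong : ∀ {x y} → x ≈ y → ord x ≡ ord y
    ord-∞    : ∀ x → (ord x ≡ ∞) ⇔ (x ≈ 0#)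
    ord-*    : ∀ x y → ord (x * y) ≡ ord x +∞ ord y
    ord-+    : ∀ x y → min∞ (ord x) (ord y) ≤∞ ord (x + y)
    ord-≥0   : ∀ x → fin ℚ.0ℚ ≤∞ ord x
    ord-7    : ord (1# + 1# + 1# + 1# + 1# + 1# + 1#) ≡ fin ℚ.1ℚ

  -- infinite matrices, indexed by positive integers (index 0 is unused)
  Mat : Set c
  Mat = ℕ → ℕ → Carrier

  sumTo : (ℕ → Carrier) → ℕ → Carrier
  sumTo f zero    = 0#
  sumTo f (suc m) = sumTo f m + f (suc m)

  -- matrix product (AB)_{ij} = Σ_{k≥1} A_{ik} B_{kj}, where the sum is
  -- taken over k ≤ 7i: this is the full sum whenever row i of A vanishes
  -- beyond column 7i (true for every left factor M_ℓ in the theorem).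
  _⊗_ : Mat → Mat → Mat
  (A ⊗ B) i j = sumTo (λ k → A i k * B k j) (7 ℕ.* i)

  idMat : Mat
  idMat i j = if i ≡ᵇ j then 1# else 0#

  prodFrom : (ℕ → Mat) → ℕ → ℕ → Mat
  prodFrom M ℓ zero    = idMat
  prodFrom M ℓ (suc k) = M ℓ ⊗ prodFrom M (suc ℓ) k

g : ℕ → ℕ → ℚ∞
g i j = if 7 ℕ.* i ℕ.<ᵇ j then ∞ else fin (gn (7 ℕ.* i ∸ j))
  where
  gn : ℕ → ℚ
  gn n = if (n % 5 ≡ᵇ 1) Data.Bool.∨ (n % 5 ≡ᵇ 3)
           then (+ n ℚ./ 12) ℚ.- ((+ (n / 5) ℤ.- + 1) ℚ./ 4)
           else (+ n ℚ./ 12) ℚ.- (+ (n / 5) ℚ./ 4)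

rhs : ℕ → ℕ → ℕ → ℚ∞
rhs a i j = fin ((+ (5 ℕ.* a) ℚ./ 12) ℚ.+ ((+ i ℤ.- + j) ℚ./ 12))

-- All exponents are measured in twelfths.  With n = 7i - k and
-- h(n) = ⌊n/5⌋ - [n ≡ 1, 3 mod 5] one has 12·g_{ik} = n - 3h(n).  We exhibit
-- explicit exponents X(m,i,j) = 5m + (i - j) + G(m,i) for the entries of a
-- product of m factors, where the "excess" G is 0, V₁, Φ - 1, Φ, Φ + 1, …
-- for m = 0, 1, 2, 3, 4, ….  The inductive step of the bound is the integer
-- inequality G(m+1, i) ≤ S(i,k) + G(m, k) for 1 ≤ k ≤ 7i, where
-- S(i,k) = 12·g_{ik} - (i - k) - 5 is the surplus of a single factor.
-- Since S(i, k+5) = S(i,k) + 3 and S(i+5, k) = S(i,k) + 9, and G(m, ·) grows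
-- by exactly 9 over a period of 5, this inequality reduces to i, k ≤ 5, which
-- is checked by evaluation (for m ≤ 2; larger m follow by a shift).
module Submission where

module NatArithmetic where

  open import Data.Nat
  open import Data.Nat.Properties
  open import Data.Nat.DivMod using (_/_; +-distrib-/-∣ʳ; m*n/n≡m)
  open import Data.Nat.Divisibility using (divides-refl)
  open import Data.Nat.Induction using (<-rec)
  open import Relation.Nullary using (yes; no)
  open import Relation.Binary.PropositionalEquality

  period-induction : ∀ {p} d .{{_ : NonZero d}} (P : ℕ → Set p) →
                     (∀ n → n < d → P n) → (∀ n → P n → P (d + n)) → ∀ n → P n
  period-induction d P base step = <-rec P induct
    where
    induct : ∀ n → (∀ {m} → m < n → P m) → P n
    induct n rec with n <? d
    ... | yes n<d = base n n<d
    ... | no n≮d  = subst P (m+[n∸m]≡n d≤n)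
                      (step (n ∸ d) (rec (∸-monoʳ-< (>-nonZero⁻¹ d) d≤n)))
      where d≤n = ≮⇒≥ n≮d

  [m+qd]/d≡m/d+q : ∀ m q d .{{_ : NonZero d}} → (m + q * d) / d ≡ m / d + q
  [m+qd]/d≡m/d+q m q d =
    trans (+-distrib-/-∣ʳ m (divides-refl q)) (cong (m / d +_) (m*n/n≡m q d))

  ∸-shift : ∀ n k d → d + k ≤ n → n ∸ k ≡ n ∸ (d + k) + d
  ∸-shift n k d d+k≤n = begin
    n ∸ k               ≡⟨ m∸n+n≡m d≤n∸k ⟨
    n ∸ k ∸ d + d       ≡⟨ cong (_+ d) (∸-+-assoc n k d) ⟩
    n ∸ (k + d) + d     ≡⟨ cong (λ x → n ∸ x + d) (+-comm k d) ⟩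
    n ∸ (d + k) + d     ∎
    where
    open ≡-Reasoning
    d≤n∸k : d ≤ n ∸ k
    d≤n∸k = subst (_≤ n ∸ k) (m+n∸n≡m d k) (∸-monoˡ-≤ k d+k≤n)

  7[5+i]∸k : ∀ i k → k ≤ 7 * i → 7 * (5 + i) ∸ k ≡ 7 * i ∸ k + 7 * 5
  7[5+i]∸k i k k≤7i = begin
    7 * (5 + i) ∸ k     ≡⟨ cong (_∸ k) (trans (*-distribˡ-+ 7 5 i) (+-comm 35 (7 * i))) ⟩
    7 * i + 35 ∸ k      ≡⟨ +-∸-comm 35 k≤7i ⟩
    7 * i ∸ k + 35      ∎
    where open ≡-Reasoning

-- Integer exponent calculus, everything counted in twelfths.
module Exponents where

  open import Data.Nat as ℕ using (ℕ; zero; suc; _∸_; _≡ᵇ_; z≤n; s≤s)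
  import Data.Nat.Properties as ℕₚ
  open import Data.Nat.DivMod using (_/_; _%_; [m+kn]%n≡m%n)
  open import Data.Integer using (ℤ; +_; _+_; _-_; _*_; _≤_; _<_; _≤?_; +≤+; +<+)
  open import Data.Integer.Properties
    using (≤-reflexive; +-monoʳ-≤; +-monoˡ-≤; +-monoʳ-<; +-assoc; +-identityʳ;
           i≤i+j; pos-*; ⊖-≥; m-n≡m⊖n; module ≤-Reasoning)
  open import Data.Integer.Tactic.RingSolver using (solve-∀)
  open import Data.Fin using (Fin; toℕ; fromℕ<)
  open import Data.Fin.Properties using (all?; toℕ-fromℕ<)
  open import Data.Bool using (true; false; if_then_else_; _∨_)
  open import Data.Unit using (tt)
  open import Relation.Nullary using (Dec)
  open import Relation.Nullary.Decidable using (True; toWitness)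
  open import Relation.Binary.PropositionalEquality
  open NatArithmetic

  decide-below5 : {P : ℕ → ℕ → Set} (P? : ∀ r t → Dec (P r t)) →
                  True (all? λ (r : Fin 5) → all? λ (t : Fin 5) → P? (toℕ r) (toℕ t)) →
                  ∀ r t → r ℕ.< 5 → t ℕ.< 5 → P r t
  decide-below5 {P} P? check r t r<5 t<5 =
    subst₂ P (toℕ-fromℕ< r<5) (toℕ-fromℕ< t<5) (toWitness check (fromℕ< r<5) (fromℕ< t<5))

  pos-∸ : ∀ n k → k ℕ.≤ n → + (n ∸ k) ≡ + n - + k
  pos-∸ n k k≤n = trans (sym (⊖-≥ k≤n)) (sym (m-n≡m⊖n n k))

  -- h(n) = ⌊n/5⌋ - [n ≡ 1, 3 (mod 5)], so that 12·g_{ik} = n - 3h(n), n = 7i - k.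
  h : ℕ → ℤ
  h n = if (n % 5 ≡ᵇ 1) ∨ (n % 5 ≡ᵇ 3) then + (n / 5) - + 1 else + (n / 5)

  h-shift : ∀ m q → h (m ℕ.+ q ℕ.* 5) ≡ h m + + q
  h-shift m q rewrite [m+kn]%n≡m%n m q 5 {{_}} | [m+qd]/d≡m/d+q m q 5 {{_}}
    with (m % 5 ≡ᵇ 1) ∨ (m % 5 ≡ᵇ 3)
  ... | true  = shuffle (+ (m / 5)) (+ q)
    where shuffle : ∀ x y → x + y - + 1 ≡ x - + 1 + y
          shuffle = solve-∀
  ... | false = refl

  -- twelve times g_{ik}, as a function of n = 7i - k
  weight : ℕ → ℤ
  weight n = + n - + 3 * h n

  -- surplus S(i,k) of one factor: 12·g_{ik} - (i - k) - 5 (see weight-split)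
  surplus : ℕ → ℕ → ℤ
  surplus i k = + 6 * + i - + 5 - + 3 * h (7 ℕ.* i ∸ k)

  weight-split : ∀ i k → k ℕ.≤ 7 ℕ.* i →
                 weight (7 ℕ.* i ∸ k) ≡ surplus i k + (+ i - + k + + 5)
  weight-split i k k≤7i = begin
    + (7 ℕ.* i ∸ k) - + 3 * H   ≡⟨ cong (λ x → x - + 3 * H) (trans (pos-∸ (7 ℕ.* i) k k≤7i)
                                                                  (cong (_- + k) (pos-* 7 i))) ⟩
    + 7 * + i - + k - + 3 * H   ≡⟨ regroup (+ i) (+ k) H ⟩
    surplus i k + (+ i - + k + + 5) ∎
    where
    open ≡-Reasoning
    H = h (7 ℕ.* i ∸ k)
    regroup : ∀ i k H → + 7 * i - k - + 3 * H ≡ + 6 * i - + 5 - + 3 * H + (i - k + + 5)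
    regroup = solve-∀

  surplus-shiftʳ : ∀ i k → 5 ℕ.+ k ℕ.≤ 7 ℕ.* i → surplus i (5 ℕ.+ k) ≡ surplus i k + + 3
  surplus-shiftʳ i k le = sym (begin
    S - + 3 * h (7 ℕ.* i ∸ k) + + 3        ≡⟨ cong (λ n → S - + 3 * h n + + 3) (∸-shift (7 ℕ.* i) k 5 le) ⟩
    S - + 3 * h (N ℕ.+ 1 ℕ.* 5) + + 3      ≡⟨ cong (λ x → S - + 3 * x + + 3) (h-shift N 1) ⟩
    S - + 3 * (h N + + 1) + + 3            ≡⟨ regroup S (h N) ⟩
    S - + 3 * h N                          ∎)
    where
    open ≡-Reasoning
    S = + 6 * + i - + 5
    N = 7 ℕ.* i ∸ (5 ℕ.+ k)
    regroup : ∀ S x → S - + 3 * (x + + 1) + + 3 ≡ S - + 3 * x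
    regroup = solve-∀

  surplus-shiftˡ : ∀ i k → k ℕ.≤ 7 ℕ.* i → surplus (5 ℕ.+ i) k ≡ surplus i k + + 9
  surplus-shiftˡ i k le = begin
    + 6 * (+ 5 + + i) - + 5 - + 3 * h (7 ℕ.* (5 ℕ.+ i) ∸ k)
      ≡⟨ cong (λ n → + 6 * (+ 5 + + i) - + 5 - + 3 * h n) (7[5+i]∸k i k le) ⟩
    + 6 * (+ 5 + + i) - + 5 - + 3 * h (N ℕ.+ 7 ℕ.* 5)
      ≡⟨ cong (λ x → + 6 * (+ 5 + + i) - + 5 - + 3 * x) (h-shift N 7) ⟩
    + 6 * (+ 5 + + i) - + 5 - + 3 * (h N + + 7)
      ≡⟨ regroup (+ i) (h N) ⟩
    surplus i k + + 9 ∎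
    where
    open ≡-Reasoning
    N = 7 ℕ.* i ∸ k
    regroup : ∀ i x → + 6 * (+ 5 + i) - + 5 - + 3 * (x + + 7) ≡ + 6 * i - + 5 - + 3 * x + + 9
    regroup = solve-∀

  surplus-bound : (A B : ℕ → ℤ) →
    (∀ k → A (suc k) ≤ A (5 ℕ.+ suc k) + + 3) →
    (∀ i → B (5 ℕ.+ suc i) ≤ B (suc i) + + 9) →
    (∀ r t → r ℕ.< 5 → t ℕ.< 5 → B (suc r) ≤ surplus (suc r) (suc t) + A (suc t)) →
    ∀ i k → suc k ℕ.≤ 7 ℕ.* suc i → B (suc i) ≤ surplus (suc i) (suc k) + A (suc k)
  surplus-bound A B A-drop B-growth base i k = period-induction 5 (ColumnBound i) small-k large-k k
    where
    open ≤-Reasoning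

    Bound : ℕ → ℕ → Set
    Bound i k = B (suc i) ≤ surplus (suc i) (suc k) + A (suc k)

    ColumnBound : ℕ → ℕ → Set
    ColumnBound i k = suc k ℕ.≤ 7 ℕ.* suc i → Bound i k

    swap : ∀ x y z → x + y + z ≡ x + z + y
    swap = solve-∀

    small-k : ∀ t → t ℕ.< 5 → ColumnBound i t
    small-k t t<5 _ = period-induction 5 (λ i → Bound i t) (λ r r<5 → base r t r<5 t<5) next-row i
      where
      t≤7i : ∀ i → suc t ℕ.≤ 7 ℕ.* suc i
      t≤7i i = ℕₚ.≤-trans t<5 (ℕₚ.≤-trans (ℕₚ.m≤m+n 5 2) (ℕₚ.m≤m*n 7 (suc i)))
      next-row : ∀ i → Bound i t → Bound (5 ℕ.+ i) t
      next-row i bound = begin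
        B (5 ℕ.+ suc i)                                       ≤⟨ B-growth i ⟩
        B (suc i) + + 9                                       ≤⟨ +-monoˡ-≤ (+ 9) bound ⟩
        surplus (suc i) (suc t) + A (suc t) + + 9             ≡⟨ swap (surplus (suc i) (suc t)) (A (suc t)) (+ 9) ⟩
        surplus (suc i) (suc t) + + 9 + A (suc t)             ≡⟨ cong (_+ A (suc t)) (surplus-shiftˡ (suc i) (suc t) (t≤7i i)) ⟨
        surplus (5 ℕ.+ suc i) (suc t) + A (suc t)             ∎

    large-k : ∀ k → ColumnBound i k → ColumnBound i (5 ℕ.+ k)
    large-k k previous le = begin
      B (suc i)                                               ≤⟨ previous (ℕₚ.m+n≤o⇒n≤o 5 le) ⟩
      surplus (suc i) (suc k) + A (suc k)                     ≤⟨ +-monoʳ-≤ (surplus (suc i) (suc k)) (A-drop k) ⟩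
      surplus (suc i) (suc k) + (A (5 ℕ.+ suc k) + + 3)       ≡⟨ sym (+-assoc (surplus (suc i) (suc k)) (A (5 ℕ.+ suc k)) (+ 3)) ⟩
      surplus (suc i) (suc k) + A (5 ℕ.+ suc k) + + 3         ≡⟨ swap (surplus (suc i) (suc k)) (A (5 ℕ.+ suc k)) (+ 3) ⟩
      surplus (suc i) (suc k) + + 3 + A (5 ℕ.+ suc k)         ≡⟨ cong (_+ A (5 ℕ.+ suc k)) (surplus-shiftʳ (suc i) (suc k) le) ⟨
      surplus (suc i) (5 ℕ.+ suc k) + A (5 ℕ.+ suc k)         ∎

  -- V₁(i) = min_{1 ≤ k ≤ 7i} surplus i k (the largest h(n), n < 7i, is ⌊(7i-1)/5⌋):
  -- the excess after one factor.
  V₁ : ℕ → ℤ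
  V₁ i = + 6 * + i - + 5 - + 3 * + ((7 ℕ.* i ∸ 1) / 5)

  V₁-shift : ∀ i → V₁ (5 ℕ.+ suc i) ≡ V₁ (suc i) + + 9
  V₁-shift i = begin
    + 6 * (+ 5 + + suc i) - + 5 - + 3 * + ((7 ℕ.* (5 ℕ.+ suc i) ∸ 1) / 5)
      ≡⟨ cong (λ n → + 6 * (+ 5 + + suc i) - + 5 - + 3 * + (n / 5)) (7[5+i]∸k (suc i) 1 (s≤s z≤n)) ⟩
    + 6 * (+ 5 + + suc i) - + 5 - + 3 * + ((N ℕ.+ 7 ℕ.* 5) / 5)
      ≡⟨ cong (λ n → + 6 * (+ 5 + + suc i) - + 5 - + 3 * + n) ([m+qd]/d≡m/d+q N 7 5) ⟩
    + 6 * (+ 5 + + suc i) - + 5 - + 3 * (+ (N / 5) + + 7)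
      ≡⟨ regroup (+ suc i) (+ (N / 5)) ⟩
    V₁ (suc i) + + 9 ∎
    where
    open ≡-Reasoning
    N = 7 ℕ.* suc i ∸ 1
    regroup : ∀ i x → + 6 * (+ 5 + i) - + 5 - + 3 * (x + + 7) ≡ + 6 * i - + 5 - + 3 * x + + 9
    regroup = solve-∀

  Φ-offset : ℕ → ℕ
  Φ-offset 1 = 3
  Φ-offset 3 = 3
  Φ-offset 4 = 6
  Φ-offset _ = 0

  Φ : ℕ → ℤ
  Φ i = + (9 ℕ.* ((i ∸ 1) / 5)) + + Φ-offset ((i ∸ 1) % 5)

  Φ-shift : ∀ i → Φ (5 ℕ.+ suc i) ≡ Φ (suc i) + + 9
  Φ-shift i = begin
    + (9 ℕ.* ((5 ℕ.+ i) / 5)) + + Φ-offset ((5 ℕ.+ i) % 5)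
      ≡⟨ cong (λ n → + (9 ℕ.* (n / 5)) + + Φ-offset (n % 5)) (ℕₚ.+-comm 5 i) ⟩
    + (9 ℕ.* ((i ℕ.+ 1 ℕ.* 5) / 5)) + + Φ-offset ((i ℕ.+ 1 ℕ.* 5) % 5)
      ≡⟨ cong₂ (λ q r → + (9 ℕ.* q) + + Φ-offset r) ([m+qd]/d≡m/d+q i 1 5) ([m+kn]%n≡m%n i 1 5) ⟩
    + (9 ℕ.* (i / 5 ℕ.+ 1)) + + Φ-offset (i % 5)
      ≡⟨ cong (λ x → + x + + Φ-offset (i % 5)) (ℕₚ.*-distribˡ-+ 9 (i / 5) 1) ⟩
    + (9 ℕ.* (i / 5)) + + 9 + + Φ-offset (i % 5)
      ≡⟨ swap (+ (9 ℕ.* (i / 5))) (+ 9) (+ Φ-offset (i % 5)) ⟩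
    Φ (suc i) + + 9 ∎
    where
    open ≡-Reasoning
    swap : ∀ x y z → x + y + z ≡ x + z + y
    swap = solve-∀

  -- G m i: excess (in twelfths, beyond 5m + i - j) of row i of an m-fold product
  G : ℕ → ℕ → ℤ
  G 0 i             = + 0
  G 1 i             = V₁ i
  G (suc (suc m)) i = Φ i - + 1 + + m

  G-shift : ∀ m i → G (suc m) (5 ℕ.+ suc i) ≡ G (suc m) (suc i) + + 9
  G-shift zero    i = V₁-shift i
  G-shift (suc m) i = trans (cong (λ x → x - + 1 + + m) (Φ-shift i)) (regroup (Φ (suc i)) (+ m))
    where regroup : ∀ x m → x + + 9 - + 1 + m ≡ x - + 1 + m + + 9
          regroup = solve-∀

  G-drop : ∀ m k → G m (suc k) ≤ G m (5 ℕ.+ suc k) + + 3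
  G-drop zero    k = +≤+ z≤n
  G-drop (suc m) k = begin
    G (suc m) (suc k)                  ≤⟨ i≤i+j (G (suc m) (suc k)) (+ 12) ⟩
    G (suc m) (suc k) + (+ 9 + + 3)    ≡⟨ sym (+-assoc (G (suc m) (suc k)) (+ 9) (+ 3)) ⟩
    G (suc m) (suc k) + + 9 + + 3      ≡⟨ cong (_+ + 3) (G-shift m k) ⟨
    G (suc m) (5 ℕ.+ suc k) + + 3      ∎
    where open ≤-Reasoning

  -- the excess G(m+1) is paid for by one factor's surplus on top of G m:
  -- for m ≤ 2 by reduction to residues checked by evaluation, beyond that
  -- by shifting the case m = 2 (both sides grow by one per factor)
  G-step : ∀ m i k → suc k ℕ.≤ 7 ℕ.* suc i →
           G (suc m) (suc i) ≤ surplus (suc i) (suc k) + G m (suc k)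
  G-step 0 = surplus-bound (G 0) (G 1) (G-drop 0) (λ i → ≤-reflexive (G-shift 0 i))
    (decide-below5 (λ r t → G 1 (suc r) ≤? surplus (suc r) (suc t) + G 0 (suc t)) tt)
  G-step 1 = surplus-bound (G 1) (G 2) (G-drop 1) (λ i → ≤-reflexive (G-shift 1 i))
    (decide-below5 (λ r t → G 2 (suc r) ≤? surplus (suc r) (suc t) + G 1 (suc t)) tt)
  G-step 2 = surplus-bound (G 2) (G 3) (G-drop 2) (λ i → ≤-reflexive (G-shift 2 i))
    (decide-below5 (λ r t → G 3 (suc r) ≤? surplus (suc r) (suc t) + G 2 (suc t)) tt)
  G-step (suc (suc (suc m))) i k le = begin
    G (4 ℕ.+ m) (suc i)                          ≡⟨ lift-row (Φ (suc i)) (+ m) ⟩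
    G 3 (suc i) + + suc m                        ≤⟨ +-monoˡ-≤ (+ suc m) (G-step 2 i k le) ⟩
    surplus (suc i) (suc k) + G 2 (suc k) + + suc m ≡⟨ lift-column (surplus (suc i) (suc k)) (Φ (suc k)) (+ m) ⟩
    surplus (suc i) (suc k) + G (3 ℕ.+ m) (suc k) ∎
    where
    open ≤-Reasoning
    lift-row : ∀ x m → x - + 1 + (+ 2 + m) ≡ x - + 1 + + 1 + (+ 1 + m)
    lift-row = solve-∀
    lift-column : ∀ s x m → s + (x - + 1 + + 0) + (+ 1 + m) ≡ s + (x - + 1 + (+ 1 + m))
    lift-column = solve-∀

  G-positive : ∀ m i → 4 ℕ.≤ m → + 0 < G m i
  G-positive 0 i ()
  G-positive 1 i (s≤s ())
  G-positive 2 i (s≤s (s≤s ()))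
  G-positive 3 i (s≤s (s≤s (s≤s ())))
  G-positive (suc (suc (suc (suc m)))) i _ = subst (+ 0 <_) (sym (regroup (Φ i) (+ m))) (+<+ (s≤s z≤n))
    where regroup : ∀ x m → x - + 1 + (+ 2 + m) ≡ + 1 + (x + m)
          regroup = solve-∀

  -- the exponent (in twelfths) of entry (i,j) of an m-fold product
  X : ℕ → ℕ → ℕ → ℤ
  X m i j = + 5 * + m + (+ i - + j) + G m i

  X-diagonal : ∀ i → X 0 i i ≡ + 0
  X-diagonal i = cancel (+ i)
    where cancel : ∀ i → + 5 * + 0 + (i - i) + + 0 ≡ + 0
          cancel = solve-∀

  X-step : ∀ m i j k → suc k ℕ.≤ 7 ℕ.* suc i →
           X (suc m) (suc i) j ≤ weight (7 ℕ.* suc i ∸ suc k) + X m (suc k) j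
  X-step m i j k le = begin
    + 5 * (+ 1 + + m) + (I - + j) + G (suc m) (suc i)
      ≤⟨ +-monoʳ-≤ (+ 5 * (+ 1 + + m) + (I - + j)) (G-step m i k le) ⟩
    + 5 * (+ 1 + + m) + (I - + j) + (S + G m (suc k))
      ≡⟨ regroup (+ m) I (+ j) K S (G m (suc k)) ⟩
    S + (I - K + + 5) + X m (suc k) j
      ≡⟨ cong (_+ X m (suc k) j) (weight-split (suc i) (suc k) le) ⟨
    weight (7 ℕ.* suc i ∸ suc k) + X m (suc k) j ∎
    where
    open ≤-Reasoning
    I = + suc i
    K = + suc k
    S = surplus (suc i) (suc k)
    regroup : ∀ m i j k s x → + 5 * (+ 1 + m) + (i - j) + (s + x) ≡ s + (i - k + + 5) + (+ 5 * m + (k - j) + x)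
    regroup = solve-∀

  X-exceeds : ∀ a i j → 4 ℕ.≤ a → + 5 * + a + (+ i - + j) < X a i j
  X-exceeds a i j 4≤a = subst (_< X a i j) (+-identityʳ target) (+-monoʳ-< target (G-positive a i 4≤a))
    where target = + 5 * + a + (+ i - + j)

-- Passage from integer exponents to rational valuations via x ↦ x/12.
module Twelfths where

  open import Data.Nat as ℕ using (suc; _∸_; _≡ᵇ_)
  import Data.Nat.Properties as ℕₚ
  open import Data.Nat.DivMod using (_/_; _%_)
  open import Data.Integer as ℤ using (ℤ; +_)
  import Data.Integer.Properties as ℤₚ
  open import Data.Integer.Tactic.RingSolver using (solve-∀)
  open import Data.Rational as ℚ using (ℚ)
  import Data.Rational.Properties as ℚₚ
  open import Data.Rational.Unnormalised as ℚᵘ using (mkℚᵘ; *≡*; *≤*; *<*)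
  import Data.Rational.Unnormalised.Properties as ℚᵘₚ
  open import Data.Bool using (true; false; T; _∨_; if_then_else_)
  open import Data.Unit using (tt)
  open import Data.Empty using (⊥-elim)
  open import Relation.Binary.PropositionalEquality
  open import Defs using (fin; g; rhs; _<∞_; fin<fin)
  open Exponents using (weight; X; X-exceeds)

  Q : ℤ → ℚ
  Q x = x ℚ./ 12

  toℚᵘ-/ : ∀ x n → ℚ.toℚᵘ (x ℚ./ suc n) ℚᵘ.≃ mkℚᵘ x n
  toℚᵘ-/ x n = ℚₚ.toℚᵘ-fromℚᵘ (mkℚᵘ x n)

  Q-+ : ∀ x y → Q x ℚ.+ Q y ≡ Q (x ℤ.+ y)
  Q-+ x y = ℚₚ.toℚᵘ-injective (begin
    ℚ.toℚᵘ (Q x ℚ.+ Q y)                 ≈⟨ ℚₚ.toℚᵘ-homo-+ (Q x) (Q y) ⟩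
    ℚ.toℚᵘ (Q x) ℚᵘ.+ ℚ.toℚᵘ (Q y)        ≈⟨ ℚᵘₚ.+-cong (toℚᵘ-/ x 11) (toℚᵘ-/ y 11) ⟩
    mkℚᵘ x 11 ℚᵘ.+ mkℚᵘ y 11             ≈⟨ *≡* (cross x y) ⟩
    mkℚᵘ (x ℤ.+ y) 11                    ≈⟨ toℚᵘ-/ (x ℤ.+ y) 11 ⟨
    ℚ.toℚᵘ (Q (x ℤ.+ y))                 ∎)
    where
    open ℚᵘₚ.≃-Reasoning
    cross : ∀ x y → (x ℤ.* + 12 ℤ.+ y ℤ.* + 12) ℤ.* + 12 ≡ (x ℤ.+ y) ℤ.* + 144
    cross = solve-∀

  -- the form in which g is written: n/12 - y/4 = (n - 3y)/12
  Q-sub-quarter : ∀ x y → x ℚ./ 12 ℚ.- y ℚ./ 4 ≡ Q (x ℤ.- + 3 ℤ.* y)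
  Q-sub-quarter x y = ℚₚ.toℚᵘ-injective (begin
    ℚ.toℚᵘ (Q x ℚ.- y ℚ./ 4)                   ≈⟨ ℚₚ.toℚᵘ-homo-+ (Q x) (ℚ.- (y ℚ./ 4)) ⟩
    ℚ.toℚᵘ (Q x) ℚᵘ.+ ℚ.toℚᵘ (ℚ.- (y ℚ./ 4))    ≈⟨ ℚᵘₚ.+-cong (toℚᵘ-/ x 11)
                                                   (ℚᵘₚ.≃-trans (ℚₚ.toℚᵘ-homo‿- (y ℚ./ 4)) (ℚᵘₚ.-‿cong (toℚᵘ-/ y 3))) ⟩
    mkℚᵘ x 11 ℚᵘ.- mkℚᵘ y 3                     ≈⟨ *≡* (cross x y) ⟩
    mkℚᵘ (x ℤ.- + 3 ℤ.* y) 11                   ≈⟨ toℚᵘ-/ (x ℤ.- + 3 ℤ.* y) 11 ⟨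
    ℚ.toℚᵘ (Q (x ℤ.- + 3 ℤ.* y))                ∎)
    where
    open ℚᵘₚ.≃-Reasoning
    cross : ∀ x y → (x ℤ.* + 4 ℤ.+ (ℤ.- y) ℤ.* + 12) ℤ.* + 12 ≡ (x ℤ.- + 3 ℤ.* y) ℤ.* + 48
    cross = solve-∀

  Q-mono-≤ : ∀ {x y} → x ℤ.≤ y → Q x ℚ.≤ Q y
  Q-mono-≤ {x} {y} x≤y = ℚₚ.toℚᵘ-cancel-≤
    (ℚᵘₚ.≤-respˡ-≃ (ℚᵘₚ.≃-sym (toℚᵘ-/ x 11)) (ℚᵘₚ.≤-respʳ-≃ (ℚᵘₚ.≃-sym (toℚᵘ-/ y 11))
      (*≤* (ℤₚ.*-monoʳ-≤-nonNeg (+ 12) x≤y))))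

  Q-mono-< : ∀ {x y} → x ℤ.< y → Q x ℚ.< Q y
  Q-mono-< {x} {y} x<y = ℚₚ.toℚᵘ-cancel-<
    (ℚᵘₚ.<-respˡ-≃ (ℚᵘₚ.≃-sym (toℚᵘ-/ x 11)) (ℚᵘₚ.<-respʳ-≃ (ℚᵘₚ.≃-sym (toℚᵘ-/ y 11))
      (*<* (ℤₚ.*-monoʳ-<-pos (+ 12) x<y))))

  g-value : ∀ i k → k ℕ.≤ 7 ℕ.* i → g i k ≡ fin (Q (weight (7 ℕ.* i ∸ k)))
  g-value i k k≤7i with 7 ℕ.* i ℕ.<ᵇ k in support
  ... | true  = ⊥-elim (ℕₚ.<⇒≱ (ℕₚ.<ᵇ⇒< (7 ℕ.* i) k (subst T (sym support) tt)) k≤7i)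
  ... | false = cong fin (g-formula (7 ℕ.* i ∸ k))
    where
    g-formula : ∀ n → (if (n % 5 ≡ᵇ 1) ∨ (n % 5 ≡ᵇ 3)
                         then (+ n ℚ./ 12) ℚ.- ((+ (n / 5) ℤ.- + 1) ℚ./ 4)
                         else (+ n ℚ./ 12) ℚ.- (+ (n / 5) ℚ./ 4)) ≡ Q (weight n)
    g-formula n with (n % 5 ≡ᵇ 1) ∨ (n % 5 ≡ᵇ 3)
    ... | true  = Q-sub-quarter (+ n) (+ (n / 5) ℤ.- + 1)
    ... | false = Q-sub-quarter (+ n) (+ (n / 5))

  rhs-below : ∀ a i j → 4 ℕ.≤ a → rhs a i j <∞ fin (Q (X a i j))
  rhs-below a i j 4≤a = fin<fin (subst (ℚ._< Q (X a i j)) (sym target) (Q-mono-< (X-exceeds a i j 4≤a)))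
    where
    target : + (5 ℕ.* a) ℚ./ 12 ℚ.+ (+ i ℤ.- + j) ℚ./ 12 ≡ Q (+ 5 ℤ.* + a ℤ.+ (+ i ℤ.- + j))
    target = trans (Q-+ (+ (5 ℕ.* a)) (+ i ℤ.- + j)) (cong (λ z → Q (z ℤ.+ (+ i ℤ.- + j))) (ℤₚ.pos-* 5 a))

module ExtendedRationals where

  import Data.Rational as ℚ
  import Data.Rational.Properties as ℚₚ
  open import Defs

  ≤∞-trans : ∀ {x y z} → x ≤∞ y → y ≤∞ z → x ≤∞ z
  ≤∞-trans (fin≤fin p≤q) (fin≤fin q≤r) = fin≤fin (ℚₚ.≤-trans p≤q q≤r)
  ≤∞-trans _             (_ ≤∞∞)       = _ ≤∞∞

  <∞-≤∞-trans : ∀ {x y z} → x <∞ y → y ≤∞ z → x <∞ z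
  <∞-≤∞-trans (fin<fin p<q) (fin≤fin q≤r) = fin<fin (ℚₚ.<-≤-trans p<q q≤r)
  <∞-≤∞-trans (fin<fin {p} _) (_ ≤∞∞)     = fin<∞ p
  <∞-≤∞-trans (fin<∞ p)     (_ ≤∞∞)       = fin<∞ p

  min∞-glb : ∀ {q x y} → fin q ≤∞ x → fin q ≤∞ y → fin q ≤∞ min∞ x y
  min∞-glb (fin≤fin q≤p) (fin≤fin q≤r) = fin≤fin (ℚₚ.⊓-glb q≤p q≤r)
  min∞-glb (fin≤fin q≤p) (_ ≤∞∞)       = fin≤fin q≤p
  min∞-glb (_ ≤∞∞)       q≤y           = q≤y

  +∞-mono : ∀ {p q x y} → fin p ≤∞ x → fin q ≤∞ y → fin (p ℚ.+ q) ≤∞ x +∞ y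
  +∞-mono (fin≤fin p≤r) (fin≤fin q≤s) = fin≤fin (ℚₚ.+-mono-≤ p≤r q≤s)
  +∞-mono (fin≤fin _)   (_ ≤∞∞)       = _ ≤∞∞
  +∞-mono (_ ≤∞∞)       _             = _ ≤∞∞

open import Defs

module Valuation {c ℓ} (R : SevenAdicRing c ℓ) where

  open import Data.Nat as ℕ using (ℕ; zero; suc; _∸_; _≤_; _<_; z≤n; s≤s)
  import Data.Nat.Properties as ℕₚ
  open import Data.Bool using (true; false; T)
  open import Data.Unit using (tt)
  open import Data.Integer using (ℤ)
  import Data.Rational as ℚ
  open import Function.Bundles using (Equivalence)
  open import Relation.Binary.PropositionalEquality
  open SevenAdicRing R using (Carrier; Mat; ord; ord-∞; ord-*; ord-+; ord-≥0; sumTo; prodFrom; idMat; _⊗_; 0#; 1#; _*_)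
  open ExtendedRationals
  open Twelfths using (Q; Q-+; Q-mono-≤; g-value)
  open Exponents using (X; X-diagonal; X-step; weight)

  GBounded : Mat → Set
  GBounded A = ∀ i j → 1 ≤ i → 1 ≤ j → g i j ≤∞ ord (A i j)

  HasExponents : Mat → (ℕ → ℕ → ℤ) → Set
  HasExponents B e = ∀ i j → 1 ≤ i → 1 ≤ j → fin (Q (e i j)) ≤∞ ord (B i j)

  ord-0 : ord 0# ≡ ∞
  ord-0 = Equivalence.from (ord-∞ 0#) (SevenAdicRing.refl R)

  ord-sum : ∀ (f : ℕ → Carrier) q N →
            (∀ k → 1 ≤ k → k ≤ N → fin q ≤∞ ord (f k)) → fin q ≤∞ ord (sumTo f N)
  ord-sum f q zero    _      = subst (fin q ≤∞_) (sym ord-0) (fin q ≤∞∞)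
  ord-sum f q (suc N) bounds = ≤∞-trans (min∞-glb earlier (bounds (suc N) (s≤s z≤n) ℕₚ.≤-refl))
                                        (ord-+ (sumTo f N) (f (suc N)))
    where earlier = ord-sum f q N (λ k 1≤k k≤N → bounds k 1≤k (ℕₚ.m≤n⇒m≤1+n k≤N))

  ord-*-bound : ∀ {p q} x y → fin p ≤∞ ord x → fin q ≤∞ ord y → fin (p ℚ.+ q) ≤∞ ord (x * y)
  ord-*-bound x y p≤x q≤y = subst (fin _ ≤∞_) (sym (ord-* x y)) (+∞-mono p≤x q≤y)

  idMat-exponents : HasExponents idMat (X 0)
  idMat-exponents i j _ _ with i ℕ.≡ᵇ j in diagonal
  ... | true  rewrite ℕₚ.≡ᵇ⇒≡ i j (subst T (sym diagonal) tt) | X-diagonal j = ord-≥0 1#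
  ... | false = subst (fin _ ≤∞_) (sym ord-0) (_ ≤∞∞)

  mul-exponents : ∀ {A B} m → GBounded A → HasExponents B (X m) → HasExponents (A ⊗ B) (X (suc m))
  mul-exponents m _ _ zero j () _
  mul-exponents {A} {B} m A-bounded B-exponents (suc i) j _ 1≤j = ord-sum _ _ (7 ℕ.* suc i) term
    where
    term : ∀ k → 1 ≤ k → k ≤ 7 ℕ.* suc i → fin (Q (X (suc m) (suc i) j)) ≤∞ ord (A (suc i) k * B k j)
    term (suc k) _ k≤7i = ≤∞-trans (fin≤fin split)
                            (ord-*-bound (A (suc i) (suc k)) (B (suc k) j) A-entry B-entry)
      where
      w = weight (7 ℕ.* suc i ∸ suc k)
      split : Q (X (suc m) (suc i) j) ℚ.≤ Q w ℚ.+ Q (X m (suc k) j)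
      split = subst (Q (X (suc m) (suc i) j) ℚ.≤_) (sym (Q-+ w (X m (suc k) j))) (Q-mono-≤ (X-step m i j k k≤7i))
      A-entry : fin (Q w) ≤∞ ord (A (suc i) (suc k))
      A-entry = subst (_≤∞ ord (A (suc i) (suc k))) (g-value (suc i) (suc k) k≤7i)
                  (A-bounded (suc i) (suc k) (s≤s z≤n) (s≤s z≤n))
      B-entry : fin (Q (X m (suc k) j)) ≤∞ ord (B (suc k) j)
      B-entry = B-exponents (suc k) j (s≤s z≤n) 1≤j

  prod-exponents : ∀ (M : ℕ → Mat) m l → (∀ l′ → l ≤ l′ → l′ < l ℕ.+ m → GBounded (M l′)) →
                   HasExponents (prodFrom M l m) (X m)
  prod-exponents M zero    l _       = idMat-exponents
  prod-exponents M (suc m) l bounded =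
    mul-exponents m (bounded l ℕₚ.≤-refl (ℕₚ.m<m+n l (s≤s z≤n)))
      (prod-exponents M m (suc l) λ l′ l<l′ l′≤l+m →
        bounded l′ (ℕₚ.<⇒≤ l<l′) (subst (l′ <_) (sym (ℕₚ.+-suc l m)) l′≤l+m))

open import Data.Nat using (ℕ; suc; _≤_; _<_; s≤s⁻¹; >-nonZero)
open import Data.Nat.Divisibility using (_∣_; ∣⇒≤)
open ExtendedRationals using (<∞-≤∞-trans)

-- Lemma 3.1: the product bound holds for a ≥ 4, and 4 ∣ a with a ≥ 1 forces a ≥ 4.
lemma3p1 : ∀ {c ℓ} (R : SevenAdicRing c ℓ) (a : ℕ) → 1 ≤ a → 4 ∣ a →
    (M : ℕ → SevenAdicRing.Mat R) →
    (∀ l i j → 1 ≤ l → l ≤ a → 1 ≤ i → 1 ≤ j → g i j ≤∞ SevenAdicRing.ord R (M l i j)) →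
    ∀ i j → 1 ≤ i → 1 ≤ j →
    rhs a i j <∞ SevenAdicRing.ord R (SevenAdicRing.prodFrom R M 1 a i j)
lemma3p1 R a 1≤a 4∣a M hyp i j 1≤i 1≤j =
  <∞-≤∞-trans (Twelfths.rhs-below a i j 4≤a) (Valuation.prod-exponents R M a 1 factors i j 1≤i 1≤j)
  where
  4≤a : 4 ≤ a
  4≤a = ∣⇒≤ {{>-nonZero 1≤a}} 4∣a
  factors : ∀ l → 1 ≤ l → l < suc a → Valuation.GBounded R (M l)
  factors l 1≤l l<1+a i j = hyp l i j 1≤l (s≤s⁻¹ l<1+a)
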